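{- Let $\mathcal{L}$ be an abstract bi-intuitionistic logic that is preserved under bi-asimulations. Then for every pointed $\Theta$-model $(\mathcal{M},w)$ with $\mathcal{M}=\langle W,\prec,V\rangle$, every $v\in W$ with $w\prec v$, and every $\phi\in L(\Theta)$: if $\mathcal{M},w\models_\mathcal{L}\phi$ then $\mathcal{M},v\models_\mathcal{L}\phi$.
   Context: A signature is a set of propositional letters. A $\Theta$-model is $\mathcal{M}=\langle W,\prec,V\rangle$ with $W\neq\varnothing$, $\prec$ a partial order, $V:\Theta\to 2^W$ monotone along $\prec$; a pointed model is $(\mathcal{M},w)$, $w\in W$. An abstract bi-intuitionistic logic $\mathcal{L}=(L,\models_\mathcal{L})$ assigns to each signature $\Theta$ a set $L(\Theta)$ of formulas (monotone in $\Theta$) with a satisfaction relation between pointed $\Theta$-models and $L(\Theta)$, isomorphism-invariant, satisfying Expansion, Occurrence, and closure under $\bot,\ll,\to,\wedge,\vee$ (with their bi-intuitionistic Kripke semantics). A bi-asimulation from $(\mathcal{M}_1,w_1)$ to $(\mathcal{M}_2,w_2)$ is $A\subseteq(W_1\times W_2)\cup(W_2\times W_1)$ with $w_1Aw_2$ such that for all $\{i,j\}=\{1,2\}$, $v\in W_i$, $s,t\in W_j$, $p\in\Theta$: if $vAs$ and $v\in V_i(p)$ then $s\in V_j(p)$; if $vAs$ and $s\prec_jt$ then some $u\in W_i$ has $v\prec_iu$, $tAu$, $uAt$; if $vAs$ and $u\prec_iv$ ($u\in W_i$) then some $t\in W_j$ has $t\prec_js$, $tAu$, $uAt$. $\mathcal{L}$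 is preserved under bi-asimulations if whenever such $A$ exists, every $L(\Theta)$-formula true at $(\mathcal{M}_1,w_1)$ is true at $(\mathcal{M}_2,w_2)$. -}

module Defs where

open import Level using (0ℓ)
open import Data.Product using (Σ; ∃; ∃-syntax; _×_; _,_)
open import Data.Sum using (_⊎_)
open import Data.Empty using (⊥)
open import Data.List using (List)
open import Data.List.Membership.Propositional using () renaming (_∈_ to _∈ₗ_)
open import Relation.Nullary using (¬_)
open import Relation.Unary using (Pred; _∈_; _⊆_)
open import Relation.Binary.PropositionalEquality using (_≡_)
open import Relation.Binary.Structures using (IsPartialOrder)

module _ (Letter : Set) where

  Signature : Set₁
  Signature = Pred Letter 0ℓ

  _⇔_ : Set → Set → Set
  A ⇔ B = (A → B) × (B → A)

  record Model (Θ : Signature) : Set₁ where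
    field
      W       : Set
      _≼_     : W → W → Set
      isPO    : IsPartialOrder _≡_ _≼_
      V       : (p : Letter) → p ∈ Θ → W → Set
      V-mono  : ∀ {p} (h : p ∈ Θ) {x y} → x ≼ y → V p h x → V p h y

  open Model public

  reduct : {Θ Θ' : Signature} → Θ ⊆ Θ' → Model Θ' → Model Θ
  reduct s M = record
    { W = W M ; _≼_ = _≼_ M ; isPO = isPO M
    ; V = λ p h → V M p (s h)
    ; V-mono = λ h → V-mono M (s h) }

  record Iso {Θ : Signature} (M₁ M₂ : Model Θ) : Set where
    field
      f      : W M₁ → W M₂
      g      : W M₂ → W M₁
      gf     : ∀ x → g (f x) ≡ x
      fg     : ∀ y → f (g y) ≡ y
      f-≼    : ∀ x y → _≼_ M₁ x y ⇔ _≼_ M₂ (f x) (f y)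
      f-V    : ∀ p (h : p ∈ Θ) x → V M₁ p h x ⇔ V M₂ p h (f x)

  ListSig : List Letter → Signature
  ListSig ps = λ p → p ∈ₗ ps

  record AbstractBiIntLogic : Set₁ where
    field
      L     : Signature → Set
      lift  : {Θ Θ' : Signature} → Θ ⊆ Θ' → L Θ → L Θ'
      _⊨_▷_ : {Θ : Signature} (M : Model Θ) → W M → L Θ → Set
      iso-inv : {Θ : Signature} {M₁ M₂ : Model Θ} (i : Iso M₁ M₂) (w : W M₁)
                (φ : L Θ) → (M₁ ⊨ w ▷ φ) ⇔ (M₂ ⊨ Iso.f i w ▷ φ)
      expansion : {Θ Θ' : Signature} (s : Θ ⊆ Θ') (M : Model Θ') (w : W M)
                  (φ : L Θ) → (M ⊨ w ▷ lift s φ) ⇔ (reduct s M ⊨ w ▷ φ)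
      occurrence : {Θ : Signature} (φ : L Θ) →
                   Σ (List Letter) λ ps → Σ (ListSig ps ⊆ Θ) λ s →
                   Σ (L (ListSig ps)) λ ψ →
                   ∀ (M : Model Θ) (w : W M) → (M ⊨ w ▷ φ) ⇔ (M ⊨ w ▷ lift s ψ)
      ⊥L   : {Θ : Signature} → L Θ
      _≪L_ : {Θ : Signature} → L Θ → L Θ → L Θ
      _→L_ : {Θ : Signature} → L Θ → L Θ → L Θ
      _∧L_ : {Θ : Signature} → L Θ → L Θ → L Θ
      _∨L_ : {Θ : Signature} → L Θ → L Θ → L Θ
      ⊥-sem : {Θ : Signature} (M : Model Θ) (w : W M) → ¬ (M ⊨ w ▷ ⊥L)
      ≪-sem : {Θ : Signature} (M : Model Θ) (w : W M) (φ ψ : L Θ) →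
              (M ⊨ w ▷ (φ ≪L ψ)) ⇔
              (∃[ v ] (_≼_ M v w × (M ⊨ v ▷ φ) × ¬ (M ⊨ v ▷ ψ)))
      →-sem : {Θ : Signature} (M : Model Θ) (w : W M) (φ ψ : L Θ) →
              (M ⊨ w ▷ (φ →L ψ)) ⇔
              (∀ v → _≼_ M w v → (M ⊨ v ▷ φ) → (M ⊨ v ▷ ψ))
      ∧-sem : {Θ : Signature} (M : Model Θ) (w : W M) (φ ψ : L Θ) →
              (M ⊨ w ▷ (φ ∧L ψ)) ⇔ ((M ⊨ w ▷ φ) × (M ⊨ w ▷ ψ))
      ∨-sem : {Θ : Signature} (M : Model Θ) (w : W M) (φ ψ : L Θ) →
              (M ⊨ w ▷ (φ ∨L ψ)) ⇔ ((M ⊨ w ▷ φ) ⊎ (M ⊨ w ▷ ψ))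

  -- The conditions of a bi-asimulation for one choice of (i,j):
  -- Aij relates W_i to W_j, Aji relates W_j to W_i.
  record BiAsimHalf {Θ : Signature} (Mi Mj : Model Θ)
         (Aij : W Mi → W Mj → Set) (Aji : W Mj → W Mi → Set) : Set where
    field
      atoms : ∀ {v s} p (h : p ∈ Θ) → Aij v s → V Mi p h v → V Mj p h s
      forth : ∀ {v s t} → Aij v s → _≼_ Mj s t →
              ∃[ u ] (_≼_ Mi v u × Aji t u × Aij u t)
      back  : ∀ {v s u} → Aij v s → _≼_ Mi u v →
              ∃[ t ] (_≼_ Mj t s × Aji t u × Aij u t)

  -- A bi-asimulation from (M₁,w₁) to (M₂,w₂); the relation
  -- A ⊆ (W₁×W₂) ∪ (W₂×W₁) is given by its two components A₁₂, A₂₁.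
  record BiAsim {Θ : Signature} (M₁ : Model Θ) (w₁ : W M₁)
         (M₂ : Model Θ) (w₂ : W M₂) : Set₁ where
    field
      A₁₂  : W M₁ → W M₂ → Set
      A₂₁  : W M₂ → W M₁ → Set
      root : A₁₂ w₁ w₂
      h₁₂  : BiAsimHalf M₁ M₂ A₁₂ A₂₁
      h₂₁  : BiAsimHalf M₂ M₁ A₂₁ A₁₂

  PreservedUnderBiAsim : AbstractBiIntLogic → Set₁
  PreservedUnderBiAsim 𝓛 =
    ∀ {Θ : Signature} (M₁ : Model Θ) (w₁ : W M₁) (M₂ : Model Θ) (w₂ : W M₂) →
    BiAsim M₁ w₁ M₂ w₂ →
    ∀ (φ : L Θ) → (M₁ ⊨ w₁ ▷ φ) → (M₂ ⊨ w₂ ▷ φ)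
    where open AbstractBiIntLogic 𝓛

module Submission where

open import Defs
open import Data.Product using (_,_)
open import Relation.Binary.Structures using (IsPartialOrder)

-- The order itself, taken in both directions, is a bi-asimulation: atoms
-- transfer upwards by monotonicity of V, and every forth/back step is
-- answered by the very same world, related to itself by reflexivity.
module _ {Letter : Set} {Θ : Signature Letter} (M : Model Letter Θ) where

  open IsPartialOrder (isPO M) using (refl; trans)

  ≼-biAsimHalf : BiAsimHalf Letter M M (_≼_ M) (_≼_ M)
  ≼-biAsimHalf = record
    { atoms = λ p h v≼s → V-mono M h v≼s
    ; forth = λ {_} {_} {t} v≼s s≼t → t , trans v≼s s≼t , refl , refl
    ; back  = λ {_} {_} {u} v≼s u≼v → u , trans u≼v v≼s , refl , refl
    }

  ≼-biAsim : ∀ {w v} → _≼_ M w v → BiAsim Letter M w M v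
  ≼-biAsim w≼v = record
    { A₁₂ = _≼_ M ; A₂₁ = _≼_ M ; root = w≼v
    ; h₁₂ = ≼-biAsimHalf ; h₂₁ = ≼-biAsimHalf }

lemma4p3 : (Letter : Set) (𝓛 : AbstractBiIntLogic Letter) →
    PreservedUnderBiAsim Letter 𝓛 →
    ∀ {Θ : Signature Letter} (M : Model Letter Θ) (w v : W M) →
    _≼_ M w v → (φ : AbstractBiIntLogic.L 𝓛 Θ) →
    AbstractBiIntLogic._⊨_▷_ 𝓛 M w φ → AbstractBiIntLogic._⊨_▷_ 𝓛 M v φ
lemma4p3 Letter 𝓛 preserved M w v w≼v = preserved M w M v (≼-biAsim M w≼v)
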